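{- Let $n\geq1$ be an integer. Then $n$ is a power of $2$ (including $n=1$) if and only if $n$ is neither even-trapezoidal nor the semi-perimeter of a Pythagorean triangle. Furthermore, with $R:=\{2^m:m\in\mathbb{Z}_{\geq0}\}$ and $S$ the set of $n\geq1$ that are neither even-trapezoidal nor semi-perimeters of Pythagorean triangles, the statement "$R=S$" is provable in $\mathbf{KR}_{2}$, i.e. $R,S\in\mathfrak{U}_{\mathbf{KR}_{2}}$ and $\gamma(R)=\gamma(S)$ where $\gamma(n)=\langle\!\langle n\rangle\!\rangle_{2}$.
   Context: $n\geq1$ is even-trapezoidal if $n=\sum_{k=0}^{2m-1}(a+k)$ for some integers $a\geq1$, $m\geq1$. $n$ is the semi-perimeter of a Pythagorean triangle if there exist integers $x,y,z\geq1$ with $x^2+y^2=z^2$ and $(x+y+z)/2=n$. For $n\geq1$, let $D_n$ be the set of divisors of $n$, $2D_n=\{2d:d\in D_n\}$, and $u_1<\dots<u_k$ the elements of $D_n\triangle 2D_n$; the word $\langle\!\langle n\rangle\!\rangle_{2}=w_1\cdots w_k\in\{a,b\}^{\ast}$ has $w_i=a$ if $u_i\in D_n\setminus2D_n$ and $w_i=b$ if $u_i\in2D_n\setminus D_n$. $\mathbf{KR}_{2}$ is the triple $(\mathbb{Z}_{\geq1},\{a,b\},\gamma)$ with $\gamma(n)=\langle\!\langle n\rangle\!\rangle_{2}$, and $\mathfrak{U}_{\mathbf{KR}_{2}}$ is the smallest $\sigma$-algebra on $\mathbb{Z}_{\geq1}$ containing all sets $\gamma^{ -1}(w)$, $w\in\{a,b\}^{\ast}$.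 -}

module Defs where

open import Level using (0ℓ)
open import Data.Nat using (ℕ; zero; suc; _+_; _*_; _^_; _≤_; _/_; _%_; _≟_)
open import Data.Nat.Divisibility using (_∣_; _∣?_)
open import Data.List using (List; []; _∷_; map; upTo; concatMap)
open import Data.Bool using (Bool; true; false; _∧_)
open import Relation.Nullary.Decidable using (⌊_⌋)
open import Data.Product using (Σ; ∃; _×_; _,_)
open import Relation.Nullary using (¬_; Dec; yes; no)
open import Relation.Unary using (Pred)
open import Relation.Binary.PropositionalEquality using (_≡_)
open import Function.Bundles using (_⇔_)

trapSum : ℕ → ℕ → ℕ
trapSum a zero    = 0
trapSum a (suc j) = trapSum a j + (a + j)

EvenTrapezoidal : ℕ → Set
EvenTrapezoidal n = ∃ λ a → ∃ λ m → 1 ≤ a × 1 ≤ m × n ≡ trapSum a (2 * m)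

PythSemiPerimeter : ℕ → Set
PythSemiPerimeter n = ∃ λ x → ∃ λ y → ∃ λ z →
  1 ≤ x × 1 ≤ y × 1 ≤ z × x * x + y * y ≡ z * z × x + y + z ≡ 2 * n

PowerOfTwo : ℕ → Set
PowerOfTwo n = ∃ λ m → n ≡ 2 ^ m

data Letter : Set where
  a b : Letter

Word : Set
Word = List Letter

-- Boolean membership tests for u ∈ D_n and u ∈ 2D_n = {2d : d ∣ n}
inD : ℕ → ℕ → Bool
inD n u = ⌊ u ∣? n ⌋

in2D : ℕ → ℕ → Bool
in2D n u = ⌊ u % 2 ≟ 0 ⌋ ∧ ⌊ (u / 2) ∣? n ⌋

letterAt : ℕ → ℕ → List Letter
letterAt n u with inD n u | in2D n u
... | true  | false = a ∷ []
... | false | true  = b ∷ []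
... | _     | _     = []

-- ⟪ n ⟫₂ : scan u = 1, 2, …, 2n in increasing order (for n ≥ 1 every element
-- of D_n ∪ 2D_n lies in [1, 2n]).
word : ℕ → Word
word n = concatMap (letterAt n) (map suc (upTo (2 * n)))

γ : ℕ → Word
γ = word

-- The underlying set is ℤ_{≥1}; subsets are predicates on ℕ, considered
-- only on positive arguments.
Pos : ℕ → Set
Pos n = 1 ≤ n

-- The σ-algebra 𝔘_{KR₂} on ℤ_{≥1} generated by the fibres γ⁻¹(w),
-- as the inductively generated (hence smallest) σ-algebra; sets are
-- identified extensionally on ℤ_{≥1}.
data Meas : Pred ℕ 0ℓ → Set₁ where
  fibre : (w : Word) → Meas (λ n → Pos n × γ n ≡ w)
  compl : ∀ {P} → Meas P → Meas (λ n → Pos n × ¬ P n)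
  union : (F : ℕ → Pred ℕ 0ℓ) → (∀ i → Meas (F i)) → Meas (λ n → ∃ λ i → F i n)
  ext   : ∀ {P Q} → Meas P → (∀ n → Pos n → (P n ⇔ Q n)) → Meas Q

R : Pred ℕ 0ℓ
R = PowerOfTwo

S : Pred ℕ 0ℓ
S n = Pos n × ¬ EvenTrapezoidal n × ¬ PythSemiPerimeter n

SameImage : Pred ℕ 0ℓ → Pred ℕ 0ℓ → Set
SameImage P Q = ∀ (w : Word) → ((∃ λ n → Pos n × P n × γ n ≡ w) ⇔ (∃ λ n → Pos n × Q n × γ n ≡ w))

-- Write n = 2^k · o with o odd.  A sum of 2m consecutive integers from a ≥ 1
-- is m · (2a + 2m − 1), a product with an odd factor greater than 1, so a
-- power of two is never even-trapezoidal; conversely, if o > 2^(k+1) then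
-- n is such a sum with m = 2^k.  In a Pythagorean triangle with
-- semi-perimeter n one has (y + z)(x + z) = 2n² with n < y + z < 2n, which is
-- impossible for a power of two n; conversely, if 2^j < o < 2^(j+1) with
-- j ≤ k, Euclid's parametrisation with p = 2^j, q = o − 2^j, scaled by
-- 2^(k−j), gives a triangle of semi-perimeter n.
--
-- For the second part, u ∈ D_n ∖ 2D_n exactly when u is an odd divisor of n,
-- so the number of letters a in ⟪n⟫₂ is the number of odd divisors of n; it
-- is 1 exactly for the powers of two.  Hence R is a countable union of fibres
-- of γ, and S agrees with R on ℤ_{≥1}.
module Submission where

open import Defs
open import Data.Nat using (ℕ; zero; suc; _+_; _*_; _^_; _≤_; _<_; _∸_; z≤n; s≤s; z<s; _/_; _%_; _≟_; _≤?_; _<?_)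
open import Data.Nat.Properties
open import Data.Nat.Divisibility using (_∣_; divides; _∣?_; ∣-trans; n∣m*n; 1∣_)
open import Data.Nat.DivMod using ([m+kn]%n≡m%n; m*n/n≡m)
open import Data.Nat.Induction using (<-rec)
open import Data.Nat.Tactic.RingSolver using (solve-∀)
open import Data.List using ([]; _∷_; map; applyUpTo; concatMap; _++_)
open import Data.List.Membership.Propositional using (_∈_)
open import Data.List.Membership.Propositional.Properties using (∈-map⁺; ∈-map⁻; ∈-applyUpTo⁺; ∈-applyUpTo⁻)
open import Data.List.Relation.Unary.Any using (here; there)
open import Data.Bool using (true; false; _∧_)
open import Data.Bool.Properties using (T-≡)
open import Data.Product using (∃₂; ∃-syntax; _×_; _,_)
open import Data.Sum using (_⊎_; inj₁; inj₂)
open import Data.Empty using (⊥)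
open import Relation.Nullary using (¬_; Dec; yes; no; contradiction)
open import Relation.Nullary.Decidable using (⌊_⌋; isYes≗does; dec-true; dec-false; toWitness)
open import Relation.Unary using (Pred)
open import Relation.Binary.PropositionalEquality
open import Function using (_∘_)
open import Function.Bundles using (_⇔_; mk⇔; Equivalence)
open import Level using (0ℓ)

parity : ∀ n → ∃[ h ] (n ≡ 2 * h ⊎ n ≡ suc (2 * h))
parity zero = 0 , inj₁ refl
parity (suc n) with parity n
... | h , inj₁ refl = h , inj₂ refl
... | h , inj₂ refl = suc h , inj₁ (cong suc (sym (+-suc h (h + 0))))

2-adic-decomposition : ∀ n → 1 ≤ n → ∃₂ λ k t → n ≡ 2 ^ k * suc (2 * t)
2-adic-decomposition = <-rec (λ n → 1 ≤ n → ∃₂ λ k t → n ≡ 2 ^ k * suc (2 * t)) step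
  where
  step : ∀ n → (∀ {h} → h < n → 1 ≤ h → ∃₂ λ k t → h ≡ 2 ^ k * suc (2 * t))
       → 1 ≤ n → ∃₂ λ k t → n ≡ 2 ^ k * suc (2 * t)
  step n rec 1≤n with parity n
  ... | t , inj₂ refl = 0 , t , sym (*-identityˡ _)
  ... | zero , inj₁ refl = contradiction 1≤n λ ()
  ... | suc h , inj₁ refl with rec (m<m+n (suc h) z<s) z<s
  ...   | k , t , h≡ = suc k , t , trans (cong (2 *_) h≡) (sym (*-assoc 2 (2 ^ k) _))

2^k≢0 : ∀ k → 2 ^ k ≢ 0
2^k≢0 k eq with m^n≡0⇒m≡0 2 k eq
... | ()

2^k*[1+2t]≡2^j⇒t≡0 : ∀ k t j → 2 ^ k * suc (2 * t) ≡ 2 ^ j → t ≡ 0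
2^k*[1+2t]≡2^j⇒t≡0 zero    zero    zero    _  = refl
2^k*[1+2t]≡2^j⇒t≡0 zero    (suc t) zero    ()
2^k*[1+2t]≡2^j⇒t≡0 zero    t       (suc j) eq =
  contradiction (trans (sym eq) (*-identityˡ _)) (even≢odd (2 ^ j) t)
2^k*[1+2t]≡2^j⇒t≡0 (suc k) t       zero    eq =
  contradiction (trans (sym (*-assoc 2 (2 ^ k) _)) eq) (even≢odd (2 ^ k * suc (2 * t)) 0)
2^k*[1+2t]≡2^j⇒t≡0 (suc k) t       (suc j) eq =
  2^k*[1+2t]≡2^j⇒t≡0 k t j (*-cancelˡ-≡ _ _ 2 (trans (sym (*-assoc 2 (2 ^ k) _)) eq))

1+2t≡2^j⇒t≡0 : ∀ t j → suc (2 * t) ≡ 2 ^ j → t ≡ 0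
1+2t≡2^j⇒t≡0 t j eq = 2^k*[1+2t]≡2^j⇒t≡0 0 t j (trans (*-identityˡ _) eq)

2^p*odd*2^r*odd : ∀ p s r u → (2 ^ p * suc (2 * s)) * (2 ^ r * suc (2 * u))
                             ≡ 2 ^ (p + r) * suc (2 * (s + u + 2 * s * u))
2^p*odd*2^r*odd p s r u =
  trans (regroup (2 ^ p) (2 ^ r) s u) (cong (_* _) (sym (^-distribˡ-+-* 2 p r)))
  where
  regroup : ∀ P R s u → (P * suc (2 * s)) * (R * suc (2 * u))
                      ≡ (P * R) * suc (2 * (s + u + 2 * s * u))
  regroup = solve-∀

∣2^⇒PowerOfTwo : ∀ {d} k → d ∣ 2 ^ k → PowerOfTwo d
∣2^⇒PowerOfTwo {zero} k (divides q eq) = contradiction (trans eq (*-zeroʳ q)) (2^k≢0 k)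
∣2^⇒PowerOfTwo {suc _} k (divides zero eq) = contradiction eq (2^k≢0 k)
∣2^⇒PowerOfTwo {d@(suc _)} k (divides q@(suc _) eq)
  with p , s , d≡ ← 2-adic-decomposition d z<s
     | r , u , q≡ ← 2-adic-decomposition q z<s =
  p , trans d≡ (trans (cong (λ s → 2 ^ p * suc (2 * s)) s≡0) (*-identityʳ _))
  where
  s≡0 : s ≡ 0
  s≡0 = m+n≡0⇒m≡0 s (m+n≡0⇒m≡0 (s + u) (2^k*[1+2t]≡2^j⇒t≡0 (p + r) _ k (begin
    2 ^ (p + r) * suc (2 * (s + u + 2 * s * u)) ≡⟨ sym (2^p*odd*2^r*odd p s r u) ⟩
    (2 ^ p * suc (2 * s)) * (2 ^ r * suc (2 * u)) ≡⟨ sym (cong₂ _*_ d≡ q≡) ⟩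
    d * q                                         ≡⟨ *-comm d q ⟩
    q * d                                         ≡⟨ sym eq ⟩
    2 ^ k                                         ∎)))
    where open ≡-Reasoning

2^-bracket : ∀ n → 1 ≤ n → ∃[ j ] 2 ^ j ≤ n × n < 2 ^ suc j
2^-bracket (suc zero) _ = 0 , ≤-refl , s≤s (s≤s z≤n)
2^-bracket (suc (suc n)) _ with 2^-bracket (suc n) z<s
... | j , lo , hi with suc (suc n) ≟ 2 ^ suc j
...   | yes eq = suc j , ≤-reflexive (sym eq) ,
                 subst (_< 2 ^ suc (suc j)) (sym eq) (^-monoʳ-< 2 (s≤s (s≤s z≤n)) (n<1+n (suc j)))
...   | no ne = j , m≤n⇒m≤1+n lo , ≤∧≢⇒< hi ne

odd-2^-bracket : ∀ t → 1 ≤ t → ∃[ j ] 2 ^ j < suc (2 * t) × suc (2 * t) < 2 ^ suc j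
odd-2^-bracket t 1≤t with 2^-bracket (suc (2 * t)) z<s
... | j , lo , hi = j , ≤∧≢⇒< lo (λ eq → <⇒≢ 1≤t (sym (1+2t≡2^j⇒t≡0 t j (sym eq)))) , hi

no-PowerOfTwo-strictly-between : ∀ {u} e → PowerOfTwo u → 2 ^ e < u → u < 2 ^ suc e → ⊥
no-PowerOfTwo-strictly-between e (i , refl) lo hi with i ≤? e
... | yes i≤e = <-irrefl refl (<-≤-trans lo (^-monoʳ-≤ 2 i≤e))
... | no i≰e  = <-irrefl refl (<-≤-trans hi (^-monoʳ-≤ 2 (≰⇒> i≰e)))

trapSum-closed : ∀ s j → 2 * trapSum s j + j ≡ j * (2 * s + j)
trapSum-closed s zero = refl
trapSum-closed s (suc j) = begin
  2 * (trapSum s j + (s + j)) + suc j         ≡⟨ split (trapSum s j) s j ⟩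
  (2 * trapSum s j + j) + (2 * s + 2 * j + 1) ≡⟨ cong (_+ (2 * s + 2 * j + 1)) (trapSum-closed s j) ⟩
  j * (2 * s + j) + (2 * s + 2 * j + 1)       ≡⟨ step s j ⟩
  suc j * (2 * s + suc j)                     ∎
  where
  open ≡-Reasoning
  split : ∀ T s j → 2 * (T + (s + j)) + suc j ≡ (2 * T + j) + (2 * s + 2 * j + 1)
  split = solve-∀
  step : ∀ s j → j * (2 * s + j) + (2 * s + 2 * j + 1) ≡ suc j * (2 * s + suc j)
  step = solve-∀

trapSum-even : ∀ c m → trapSum (suc c) (2 * m) ≡ m * suc (2 * (c + m))
trapSum-even c m =
  *-cancelˡ-≡ _ _ 2 (+-cancelʳ-≡ (2 * m) _ _ (trans (trapSum-closed (suc c) (2 * m)) (regroup c m)))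
  where
  regroup : ∀ c m → 2 * m * (2 * suc c + 2 * m) ≡ 2 * (m * suc (2 * (c + m))) + 2 * m
  regroup = solve-∀

2^-not-EvenTrapezoidal : ∀ e → ¬ EvenTrapezoidal (2 ^ e)
2^-not-EvenTrapezoidal e (suc c , m@(suc _) , _ , _ , eq)
  with i , odd≡2^i ← ∣2^⇒PowerOfTwo e (divides m (trans eq (trapSum-even c m))) =
  contradiction (m+n≡0⇒n≡0 c (1+2t≡2^j⇒t≡0 (c + m) i odd≡2^i)) λ ()

EvenTrapezoidal-2^k*[1+2t] : ∀ k t → 2 ^ k ≤ t → EvenTrapezoidal (2 ^ k * suc (2 * t))
EvenTrapezoidal-2^k*[1+2t] k t 2^k≤t =
  suc (t ∸ 2 ^ k) , 2 ^ k , s≤s z≤n , m^n>0 2 k ,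
  sym (trans (trapSum-even (t ∸ 2 ^ k) (2 ^ k)) (cong (λ c → 2 ^ k * suc (2 * c)) (m∸n+n≡m 2^k≤t)))

-- Euclid's parametrisation with generators p = V + W > q = V, scaled by C.
euclid-PythSemiPerimeter : ∀ C V W → 1 ≤ C → 1 ≤ V → 1 ≤ W
                         → PythSemiPerimeter (C * (V + W) * (2 * V + W))
euclid-PythSemiPerimeter C@(suc _) V@(suc _) W@(suc _) _ _ _ =
  C * (W * (2 * V + W)) , 2 * C * (V + W) * V , C * ((V + W) * (V + W) + V * V) ,
  s≤s z≤n , s≤s z≤n , s≤s z≤n , pythagoras C V W , perimeter C V W
  where
  pythagoras : ∀ C V W → (C * (W * (2 * V + W))) * (C * (W * (2 * V + W)))
                         + (2 * C * (V + W) * V) * (2 * C * (V + W) * V)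
                       ≡ (C * ((V + W) * (V + W) + V * V)) * (C * ((V + W) * (V + W) + V * V))
  pythagoras = solve-∀
  perimeter : ∀ C V W → C * (W * (2 * V + W)) + 2 * C * (V + W) * V + C * ((V + W) * (V + W) + V * V)
                      ≡ 2 * (C * (V + W) * (2 * V + W))
  perimeter = solve-∀

PythSemiPerimeter-2^k*o : ∀ {k j o} → j ≤ k → 2 ^ j < o → o < 2 ^ suc j → PythSemiPerimeter (2 ^ k * o)
PythSemiPerimeter-2^k*o {k} {j} {o} j≤k 2^j<o o<2^[1+j] =
  subst PythSemiPerimeter semiperimeter (euclid-PythSemiPerimeter C V W (m^n>0 2 (k ∸ j)) 1≤V 1≤W)
  where
  regroup : ∀ V W → 2 * V + W ≡ V + (V + W)
  regroup = solve-∀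
  C = 2 ^ (k ∸ j)
  V = o ∸ 2 ^ j
  W = 2 ^ j ∸ V
  1≤V : 1 ≤ V
  1≤V = m<n⇒0<n∸m 2^j<o
  V+2^j≡o : V + 2 ^ j ≡ o
  V+2^j≡o = m∸n+n≡m (<⇒≤ 2^j<o)
  V<2^j : V < 2 ^ j
  V<2^j = +-cancelʳ-< (2 ^ j) V (2 ^ j)
            (subst₂ _<_ (sym V+2^j≡o) (cong (2 ^ j +_) (+-identityʳ _)) o<2^[1+j])
  1≤W : 1 ≤ W
  1≤W = m<n⇒0<n∸m V<2^j
  V+W≡2^j : V + W ≡ 2 ^ j
  V+W≡2^j = m+[n∸m]≡n (<⇒≤ V<2^j)
  semiperimeter : C * (V + W) * (2 * V + W) ≡ 2 ^ k * o
  semiperimeter = cong₂ _*_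
    (trans (cong (C *_) V+W≡2^j) (trans (sym (^-distribˡ-+-* 2 (k ∸ j) j)) (cong (2 ^_) (m∸n+n≡m j≤k))))
    (trans (regroup V W) (trans (cong (V +_) V+W≡2^j) V+2^j≡o))

pythagorean-factorisation : ∀ {x y z n} → x * x + y * y ≡ z * z → x + y + z ≡ 2 * n
                          → (y + z) * (x + z) ≡ 2 * n * n
pythagorean-factorisation {x} {y} {z} {n} pyth perim = *-cancelˡ-≡ _ _ 2 (begin
  2 * ((y + z) * (x + z))                               ≡⟨ expand x y z ⟩
  z * z + z * z + 2 * (x * y + x * z + y * z)           ≡⟨ cong (λ w → w + z * z + 2 * (x * y + x * z + y * z)) (sym pyth) ⟩
  (x * x + y * y) + z * z + 2 * (x * y + x * z + y * z) ≡⟨ sym (square x y z) ⟩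
  (x + y + z) * (x + y + z)                             ≡⟨ cong₂ _*_ perim perim ⟩
  2 * n * (2 * n)                                       ≡⟨ double n ⟩
  2 * (2 * n * n)                                       ∎)
  where
  open ≡-Reasoning
  expand : ∀ x y z → 2 * ((y + z) * (x + z)) ≡ z * z + z * z + 2 * (x * y + x * z + y * z)
  expand = solve-∀
  square : ∀ x y z → (x + y + z) * (x + y + z) ≡ (x * x + y * y) + z * z + 2 * (x * y + x * z + y * z)
  square = solve-∀
  double : ∀ n → 2 * n * (2 * n) ≡ 2 * (2 * n * n)
  double = solve-∀

2^-not-PythSemiPerimeter : ∀ e → ¬ PythSemiPerimeter (2 ^ e)
2^-not-PythSemiPerimeter e (x , y , z , 1≤x , 1≤y , _ , pyth , perim)
  = no-PowerOfTwo-strictly-between e (∣2^⇒PowerOfTwo (suc (e + e)) (divides (x + z) 2^[1+2e]≡))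
      n<y+z y+z<2n
  where
  rotate : ∀ x y z → y + z + x ≡ x + y + z
  rotate = solve-∀
  swap : ∀ x y z → x + z + y ≡ x + y + z
  swap = solve-∀
  n = 2 ^ e
  factorisation : (y + z) * (x + z) ≡ 2 * n * n
  factorisation = pythagorean-factorisation {x} {y} {z} {n} pyth perim
  2^[1+2e]≡ : 2 ^ suc (e + e) ≡ (x + z) * (y + z)
  2^[1+2e]≡ = sym (trans (*-comm (x + z) (y + z)) (trans factorisation
                (trans (*-assoc 2 n n) (cong (2 *_) (sym (^-distribˡ-+-* 2 e e))))))
  y+z<2n : y + z < 2 * n
  y+z<2n = subst (y + z <_) (trans (rotate x y z) perim) (m<m+n (y + z) 1≤x)
  x+z<2n : x + z < 2 * n
  x+z<2n = subst (x + z <_) (trans (swap x y z) perim) (m<m+n (x + z) 1≤y)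
  n<y+z : n < y + z
  n<y+z with n <? y + z
  ... | yes n<y+z = n<y+z
  ... | no n≮y+z = contradiction factorisation (<⇒≢ (begin-strict
        (y + z) * (x + z) ≤⟨ *-monoˡ-≤ (x + z) (≮⇒≥ n≮y+z) ⟩
        n * (x + z)       <⟨ *-monoʳ-< n x+z<2n ⟩
        n * (2 * n)       ≡⟨ trans (sym (*-assoc n 2 n)) (cong (_* n) (*-comm n 2)) ⟩
        2 * n * n         ∎))
    where
    open ≤-Reasoning
    instance _ = m^n≢0 2 e

EvenTrapezoidal⊎PythSemiPerimeter : ∀ k t → 1 ≤ t
  → EvenTrapezoidal (2 ^ k * suc (2 * t)) ⊎ PythSemiPerimeter (2 ^ k * suc (2 * t))
EvenTrapezoidal⊎PythSemiPerimeter k t 1≤t with odd-2^-bracket t 1≤t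
... | j , 2^j<o , o<2^[1+j] with j ≤? k
...   | yes j≤k = inj₂ (PythSemiPerimeter-2^k*o j≤k 2^j<o o<2^[1+j])
...   | no j≰k  = inj₁ (EvenTrapezoidal-2^k*[1+2t] k t
                    (*-cancelˡ-≤ 2 (≤-pred (≤-<-trans (^-monoʳ-≤ 2 (≰⇒> j≰k)) 2^j<o))))

PowerOfTwo⇔¬EvenTrapezoidal×¬PythSemiPerimeter : ∀ n → 1 ≤ n
  → PowerOfTwo n ⇔ (¬ EvenTrapezoidal n × ¬ PythSemiPerimeter n)
PowerOfTwo⇔¬EvenTrapezoidal×¬PythSemiPerimeter n 1≤n = mk⇔ to from
  where
  to : PowerOfTwo n → ¬ EvenTrapezoidal n × ¬ PythSemiPerimeter n
  to (e , refl) = 2^-not-EvenTrapezoidal e , 2^-not-PythSemiPerimeter e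
  from : ¬ EvenTrapezoidal n × ¬ PythSemiPerimeter n → PowerOfTwo n
  from (¬ET , ¬PSP) with 2-adic-decomposition n 1≤n
  ... | k , zero , n≡ = k , trans n≡ (*-identityʳ _)
  ... | k , suc t , n≡ with EvenTrapezoidal⊎PythSemiPerimeter k (suc t) z<s
  ...   | inj₁ et  = contradiction (subst EvenTrapezoidal (sym n≡) et) ¬ET
  ...   | inj₂ psp = contradiction (subst PythSemiPerimeter (sym n≡) psp) ¬PSP

#a : Word → ℕ
#a []      = 0
#a (a ∷ w) = suc (#a w)
#a (b ∷ w) = #a w

#a-++ : ∀ v w → #a (v ++ w) ≡ #a v + #a w
#a-++ []      w = refl
#a-++ (a ∷ v) w = cong suc (#a-++ v w)
#a-++ (b ∷ v) w = #a-++ v w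

#a-concatMap-≡0 : ∀ (f : ℕ → Word) xs → (∀ {x} → x ∈ xs → #a (f x) ≡ 0) → #a (concatMap f xs) ≡ 0
#a-concatMap-≡0 f []       _ = refl
#a-concatMap-≡0 f (x ∷ xs) h =
  trans (#a-++ (f x) _) (cong₂ _+_ (h (here refl)) (#a-concatMap-≡0 f xs (h ∘ there)))

#a-concatMap-∈ : ∀ (f : ℕ → Word) {x xs} → x ∈ xs → #a (f x) ≤ #a (concatMap f xs)
#a-concatMap-∈ f {xs = y ∷ ys} (here refl) =
  subst (#a (f y) ≤_) (sym (#a-++ (f y) _)) (m≤m+n _ _)
#a-concatMap-∈ f {xs = y ∷ ys} (there x∈ys) =
  subst (_ ≤_) (sym (#a-++ (f y) _)) (≤-trans (#a-concatMap-∈ f x∈ys) (m≤n+m _ _))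

⌊⌋-true : ∀ {A : Set} (A? : Dec A) → A → ⌊ A? ⌋ ≡ true
⌊⌋-true A? x = trans (isYes≗does A?) (dec-true A? x)

⌊⌋-false : ∀ {A : Set} (A? : Dec A) → ¬ A → ⌊ A? ⌋ ≡ false
⌊⌋-false A? ¬x = trans (isYes≗does A?) (dec-false A? ¬x)

#a-letterAt-D∖2D : ∀ {n u} → inD n u ≡ true → in2D n u ≡ false → #a (letterAt n u) ≡ 1
#a-letterAt-D∖2D {n} {u} _ _ with inD n u | in2D n u
#a-letterAt-D∖2D refl refl | true | false = refl

#a-letterAt-D⊆2D : ∀ {n u} → (u ∣ n → in2D n u ≡ true) → #a (letterAt n u) ≡ 0
#a-letterAt-D⊆2D {n} {u} D⊆2D with inD n u in u∈D | in2D n u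
... | true  | true  = refl
... | false | true  = refl
... | false | false = refl
... | true  | false = contradiction (D⊆2D (toWitness (Equivalence.from T-≡ u∈D))) λ ()

#a-letterAt-odd : ∀ {n u} → u ∣ n → u % 2 ≡ 1 → #a (letterAt n u) ≡ 1
#a-letterAt-odd {n} {u} u∣n u%2≡1 = #a-letterAt-D∖2D (⌊⌋-true (u ∣? n) u∣n)
  (cong (_∧ ⌊ u / 2 ∣? n ⌋) (⌊⌋-false (u % 2 ≟ 0) λ u%2≡0 → 1+n≢0 (trans (sym u%2≡1) u%2≡0)))

#a-letterAt-even : ∀ {n u} → (u ∣ n → u % 2 ≡ 0 × u / 2 ∣ n) → #a (letterAt n u) ≡ 0
#a-letterAt-even {n} {u} h = #a-letterAt-D⊆2D λ u∣n → in2D-true (h u∣n)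
  where
  in2D-true : u % 2 ≡ 0 × u / 2 ∣ n → in2D n u ≡ true
  in2D-true (u%2≡0 , u/2∣n) = cong₂ _∧_ (⌊⌋-true (u % 2 ≟ 0) u%2≡0) (⌊⌋-true (u / 2 ∣? n) u/2∣n)

-- With n = suc m, word n reduces to
--   letterAt n 1 ++ concatMap (letterAt n) (map suc (applyUpTo suc (m + 1 * n))),
-- the letter of u = 1 followed by those of u = 2, …, 2n.
≥2-if-∈-tail : ∀ {m u} → u ∈ map suc (applyUpTo suc m) → 2 ≤ u
≥2-if-∈-tail u∈ with ∈-map⁻ suc u∈
... | v , v∈ , refl with ∈-applyUpTo⁻ suc v∈
...   | i , _ , refl = s≤s (s≤s z≤n)

∈-tail : ∀ {m} i → i < m → suc (suc i) ∈ map suc (applyUpTo suc m)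
∈-tail i i<m = ∈-map⁺ suc (∈-applyUpTo⁺ suc i<m)

#a-word≡1 : ∀ {n} → 1 ≤ n → (∀ {u} → 2 ≤ u → u ∣ n → u % 2 ≡ 0 × u / 2 ∣ n) → #a (word n) ≡ 1
#a-word≡1 {n@(suc m)} _ even = trans (#a-++ (letterAt n 1) _)
  (cong₂ _+_ (#a-letterAt-odd (1∣ n) refl)
             (#a-concatMap-≡0 (letterAt n) (map suc (applyUpTo suc (m + 1 * n)))
                              λ u∈ → #a-letterAt-even (even (≥2-if-∈-tail u∈))))

#a-word≥2 : ∀ {n o} → 1 < o → o ≤ n → o ∣ n → o % 2 ≡ 1 → 2 ≤ #a (word n)
#a-word≥2 {n@(suc m)} {o@(suc (suc i))} (s≤s (s≤s _)) (s≤s o≤1+m) o∣n o%2≡1 = begin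
  2                                                    ≡⟨ cong₂ _+_ (sym (#a-letterAt-odd (1∣ n) refl))
                                                                       (sym (#a-letterAt-odd o∣n o%2≡1)) ⟩
  #a (letterAt n 1) + #a (letterAt n o)                ≤⟨ +-monoʳ-≤ _ (#a-concatMap-∈ (letterAt n) (∈-tail i i<2m)) ⟩
  #a (letterAt n 1) + #a (concatMap (letterAt n) tail) ≡⟨ sym (#a-++ (letterAt n 1) _) ⟩
  #a (word n)                                          ∎
  where
  open ≤-Reasoning
  tail = map suc (applyUpTo suc (m + 1 * n))
  i<2m : i < m + 1 * n
  i<2m = ≤-trans o≤1+m (m≤m+n m _)

[1+2t]%2≡1 : ∀ t → suc (2 * t) % 2 ≡ 1
[1+2t]%2≡1 t = trans (cong (λ x → suc x % 2) (*-comm 2 t)) ([m+kn]%n≡m%n 1 t 2)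

2^[1+p]-half : ∀ p → 2 ^ suc p % 2 ≡ 0 × 2 ^ suc p / 2 ≡ 2 ^ p
2^[1+p]-half p rewrite *-comm 2 (2 ^ p) = [m+kn]%n≡m%n 0 (2 ^ p) 2 , m*n/n≡m (2 ^ p) 2

#a-word-2^ : ∀ i → #a (word (2 ^ i)) ≡ 1
#a-word-2^ i = #a-word≡1 (m^n>0 2 i) even
  where
  even : ∀ {u} → 2 ≤ u → u ∣ 2 ^ i → u % 2 ≡ 0 × u / 2 ∣ 2 ^ i
  even 2≤u u∣2^i with ∣2^⇒PowerOfTwo i u∣2^i
  ... | zero  , refl = contradiction 2≤u λ { (s≤s ()) }
  ... | suc p , refl with 2^[1+p]-half p
  ...   | u%2≡0 , u/2≡2^p = u%2≡0 , subst (_∣ 2 ^ i) (sym u/2≡2^p) (∣-trans (n∣m*n 2) u∣2^i)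

#a-word≤1⇒PowerOfTwo : ∀ n → 1 ≤ n → #a (word n) ≤ 1 → PowerOfTwo n
#a-word≤1⇒PowerOfTwo n 1≤n #a≤1 with 2-adic-decomposition n 1≤n
... | k , zero , n≡ = k , trans n≡ (*-identityʳ _)
... | k , suc t , n≡ =
  contradiction (≤-trans (#a-word≥2 (s≤s (s≤s z≤n)) o≤n o∣n ([1+2t]%2≡1 (suc t))) #a≤1) λ { (s≤s ()) }
  where
  o = suc (2 * suc t)
  o∣n : o ∣ n
  o∣n = divides (2 ^ k) n≡
  o≤n : o ≤ n
  o≤n = subst (o ≤_) (sym n≡) (m≤n*m o (2 ^ k) {{m^n≢0 2 k}})

Meas-R : Meas R
Meas-R = ext (union (λ i n → Pos n × γ n ≡ γ (2 ^ i)) (λ i → fibre (γ (2 ^ i)))) λ n pn →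
  mk⇔ (λ { (i , _ , γn≡) → #a-word≤1⇒PowerOfTwo n pn (≤-reflexive (trans (cong #a γn≡) (#a-word-2^ i))) })
      (λ { (e , n≡2^e) → e , pn , cong γ n≡2^e })

R⇔S : ∀ n → Pos n → R n ⇔ S n
R⇔S n pn = mk⇔ (λ r → pn , to r) (λ { (_ , s) → from s })
  where open Equivalence (PowerOfTwo⇔¬EvenTrapezoidal×¬PythSemiPerimeter n pn)

SameImage-ext : ∀ {P Q : Pred ℕ 0ℓ} → (∀ n → Pos n → P n ⇔ Q n) → SameImage P Q
SameImage-ext P⇔Q w = mk⇔
  (λ { (n , pn , Pn , γn≡w) → n , pn , Equivalence.to   (P⇔Q n pn) Pn , γn≡w })
  (λ { (n , pn , Qn , γn≡w) → n , pn , Equivalence.from (P⇔Q n pn) Qn , γn≡w })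

theorem21 : (∀ (n : ℕ) → 1 ≤ n → (PowerOfTwo n ⇔ (¬ EvenTrapezoidal n × ¬ PythSemiPerimeter n)))
    × Meas R × Meas S × SameImage R S
theorem21 = PowerOfTwo⇔¬EvenTrapezoidal×¬PythSemiPerimeter , Meas-R , ext Meas-R R⇔S , SameImage-ext R⇔S
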